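{- Let $L_n$ be the ladder graph, i.e. the Cartesian product $P_2\times P_n$ of a path with $2$ vertices and a path with $n$ vertices (so $L_n$ has $2n$ vertices and $3n-2$ edges; $L_1=P_2$ and $L_2$ is the $4$-cycle). Then $C(L_1)=2$, $C(L_2)=12$, and for all $n>2$, \[C(L_n)=6\cdot C(L_{n-1})+C(L_{n-2}).\]
   Context: For a finite labelled graph $G$, a composition of $G$ is a partition of the vertex set $V(G)$ into nonempty blocks such that each block induces a connected subgraph of $G$. $C(G)$ denotes the number of distinct compositions of $G$. -}

module Defs where

open import Data.Nat using (ℕ; zero; suc; _*_; _∸_)
open import Data.Nat.Base using (_≡ᵇ_)
open import Data.Bool using (Bool; true; false; _∧_; _∨_; not; if_then_else_)
open import Data.Fin using (Fin; toℕ; remQuot)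
open import Data.Fin.Properties using () renaming (_≟_ to _≟F_)
open import Data.Product using (_×_; _,_)
open import Data.List using (List; []; _∷_; map; concatMap; filter; length; allFin)
open import Data.Bool.ListAction using (all; any)
open import Data.Vec using (Vec; []; _∷_; lookup)
open import Relation.Nullary.Decidable using (⌊_⌋)
open import Relation.Unary using (Decidable)
open import Function using (_∘_)

record Graph (n : ℕ) : Set where
  field
    adj : Fin n → Fin n → Bool
open Graph public

_==_ : ∀ {n} → Fin n → Fin n → Bool
i == j = ⌊ i ≟F j ⌋

Path : (n : ℕ) → Graph n
adj (Path n) i j = ((suc (toℕ i)) ≡ᵇ (toℕ j)) ∨ ((suc (toℕ j)) ≡ᵇ (toℕ i))

_□_ : ∀ {m k} → Graph m → Graph k → Graph (m * k)
adj (_□_ {m} {k} G H) x y with remQuot {m} k x | remQuot {m} k y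
... | (u₁ , u₂) | (v₁ , v₂) = ((u₁ == v₁) ∧ adj H u₂ v₂) ∨ ((u₂ == v₂) ∧ adj G u₁ v₁)

Ladder : (n : ℕ) → Graph (2 * n)
Ladder n = Path 2 □ Path n

Rel : ℕ → Set
Rel n = Vec (Vec Bool n) n

rel : ∀ {n} → Rel n → Fin n → Fin n → Bool
rel R i j = lookup (lookup R i) j

allVecs : {A : Set} → List A → (k : ℕ) → List (Vec A k)
allVecs xs zero = [] ∷ []
allVecs xs (suc k) = concatMap (λ x → map (x ∷_) (allVecs xs k)) xs

allRels : (n : ℕ) → List (Rel n)
allRels n = allVecs (allVecs (true ∷ false ∷ []) n) n

∀F : ∀ {n} → (Fin n → Bool) → Bool
∀F {n} p = all p (allFin n)

∃F : ∀ {n} → (Fin n → Bool) → Bool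
∃F {n} p = any p (allFin n)

_⇒_ : Bool → Bool → Bool
a ⇒ b = not a ∨ b

-- R is an equivalence relation (= a partition of the vertex set into
-- nonempty blocks, namely its equivalence classes).
isEquivalence : ∀ {n} → Rel n → Bool
isEquivalence R =
  ∀F (λ i → rel R i i) ∧
  ∀F (λ i → ∀F (λ j → rel R i j ⇒ rel R j i)) ∧
  ∀F (λ i → ∀F (λ j → ∀F (λ k → (rel R i j ∧ rel R j k) ⇒ rel R i k)))

reachWithin : ∀ {n} → Graph n → Rel n → ℕ → Fin n → Fin n → Bool
reachWithin G R zero u v = (u == v) ∧ rel R u v
reachWithin G R (suc s) u v =
  reachWithin G R s u v ∨
  ∃F (λ w → reachWithin G R s u w ∧ adj G w v ∧ rel R u v)

-- Every block induces a connected subgraph: any two vertices in the same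
-- block are joined by a walk inside the block (length ≤ n suffices).
blocksConnected : ∀ {n} → Graph n → Rel n → Bool
blocksConnected {n} G R =
  ∀F (λ u → ∀F (λ v → rel R u v ⇒ reachWithin G R n u v))

isComposition : ∀ {n} → Graph n → Rel n → Bool
isComposition G R = isEquivalence R ∧ blocksConnected G R

C : ∀ {n} → Graph n → ℕ
C {n} G = length (filter (λ R → isComposition G R Data.Bool.≟ true) (allRels n))

module Submission where

-- Cutting off the last rung new 0 — new 1 of a ladder restricts a composition to one of the
-- shorter ladder, together with three bits: whether each new vertex lies in the block of its
-- old neighbour, and whether the two new vertices share a block. Conversely each composition
-- of the shorter ladder extends exactly once for each triple that is consistent with whether
-- the two old ends share a block: 5 triples if they do, 7 if not, of which 2 resp. 3 join the
-- new rung. Writing J n and S n for the compositions of L (n + 1) with joined resp. split last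
-- rung, C (L (n + 2)) = 5 J n + 7 S n and J (n + 1) = 2 J n + 3 S n, and eliminating J and S
-- gives the recurrence.

open import Defs
open import Data.Nat using (ℕ; zero; suc; _+_; _*_; _≤_; _<_; z≤n; s≤s; _≡ᵇ_)
open import Data.Nat.Properties
  using ( suc-injective; ≤-refl; ≤-reflexive; ≤-trans; m≤n⇒m≤1+n; n≤1+n; <⇒≱; +-suc; +-comm; *-zeroʳ
        ; +-cancelˡ-≡; m≤n⇒∃[o]m+o≡n; ≡ᵇ⇒≡; ≡⇒≡ᵇ)
open import Data.Nat.ListAction using (sum)
open import Data.Nat.Tactic.RingSolver using (solve-∀)
open import Data.Bool using (Bool; true; false; _∧_; _∨_; not; if_then_else_)
import Data.Bool as Bool
open import Data.Bool.ListAction using (all; any)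
open import Data.Bool.Properties using (∧-identityʳ; ∨-comm; T-≡)
open import Data.Fin using (Fin; zero; suc; toℕ; combine; remQuot; inject₁; fromℕ)
open import Data.Fin.Properties
  using ( remQuot-combine; combine-remQuot; toℕ-inject₁; toℕ-fromℕ; toℕ-injective; inject₁-injective
        ; fromℕ≢inject₁; toℕ<n)
  renaming (_≟_ to _≟F_)
open import Data.Fin.Relation.Unary.Top
  using (View; view; ‵fromℕ; ‵inject₁; ⟦_⟧; view-complete; view-fromℕ; view-inject₁)
open import Data.List
  using (List; []; _∷_; _++_; length; map; filter; concatMap; allFin; cartesianProduct; cartesianProductWith)
open import Data.List.Properties using (length-map; length-tabulate; map-∘; map-id-local)
open import Data.List.Membership.Propositional using (_∈_)
open import Data.List.Membership.Propositional.Properties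
  using (∈-allFin; ∈-filter⁺; ∈-filter⁻; ∈-map⁺; ∈-map⁻; ∈-cartesianProduct⁺; ∈-cartesianProductWith⁺)
open import Data.List.Membership.Propositional.Properties.WithK using (unique∧set⇒bag)
open import Data.List.Relation.Unary.Any using (here; there)
open import Data.List.Relation.Unary.All using ([]; _∷_)
import Data.List.Relation.Unary.All as All
open import Data.List.Relation.Unary.All.Properties using (all-filter)
open import Data.List.Relation.Unary.AllPairs using ([]; _∷_)
open import Data.List.Relation.Unary.Unique.Propositional using (Unique)
import Data.List.Relation.Unary.Unique.Propositional.Properties as Unique
open import Data.List.Relation.Binary.BagAndSetEquality using (∼bag⇒↭)
open import Data.List.Relation.Binary.Permutation.Propositional.Properties using (↭-length)
open import Data.Vec using ([]; _∷_; tabulate; lookup)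
open import Data.Vec.Properties using (∷-injective; lookup∘tabulate; tabulate∘lookup; tabulate-cong)
open import Data.Product using (∃; ∃-syntax; _×_; _,_; proj₁; proj₂; uncurry)
open import Data.Sum using (_⊎_; inj₁; inj₂; [_,_])
open import Data.Sum.Properties using (inj₁-injective)
open import Data.Empty using (⊥-elim)
open import Function using (id; _∘_; _⇔_; mk⇔; Equivalence)
open import Relation.Nullary using (yes; no)
open import Relation.Binary.Structures using (IsEquivalence)
open import Relation.Binary.PropositionalEquality hiding (isEquivalence; [_])

private variable A B D : Set

∧-elimˡ : ∀ {a b} → a ∧ b ≡ true → a ≡ true
∧-elimˡ {true} _ = refl

∧-elimʳ : ∀ {a b} → a ∧ b ≡ true → b ≡ true
∧-elimʳ {true} p = p

∧-intro : ∀ {a b} → a ≡ true → b ≡ true → a ∧ b ≡ true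
∧-intro refl refl = refl

∨-elim : ∀ {a b} → a ∨ b ≡ true → a ≡ true ⊎ b ≡ true
∨-elim {true} _ = inj₁ refl
∨-elim {false} p = inj₂ p

∨-introˡ : ∀ {a b} → a ≡ true → a ∨ b ≡ true
∨-introˡ refl = refl

∨-introʳ : ∀ a {b} → b ≡ true → a ∨ b ≡ true
∨-introʳ true _ = refl
∨-introʳ false p = p

∧-false-elimˡ : ∀ {a b} → a ∧ b ≡ false → b ≡ true → a ≡ false
∧-false-elimˡ {a} h refl = trans (sym (∧-identityʳ a)) h

∧₃-elim : ∀ {a b c} → a ∧ b ∧ c ≡ true → a ≡ true × b ≡ true × c ≡ true
∧₃-elim {true} {true} {true} _ = refl , refl , refl

⇒-elim : ∀ {a b} → a ⇒ b ≡ true → a ≡ true → b ≡ true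
⇒-elim {true} p refl = p

⇒-intro : ∀ {a b} → (a ≡ true → b ≡ true) → a ⇒ b ≡ true
⇒-intro {true} f = f refl
⇒-intro {false} f = refl

⇒-counterexample : ∀ {a b} → a ⇒ b ≡ false → a ≡ true × b ≡ false
⇒-counterexample {true} {false} _ = refl , refl

true-ext : ∀ {a b} → (a ≡ true → b ≡ true) → (b ≡ true → a ≡ true) → a ≡ b
true-ext {true} f g = sym (f refl)
true-ext {false} {true} f g = g refl
true-ext {false} {false} f g = refl

==⇒≡ : ∀ {n} {i j : Fin n} → (i == j) ≡ true → i ≡ j
==⇒≡ {i = i} {j} p with i ≟F j
... | yes i≡j = i≡j

==-refl : ∀ {n} (i : Fin n) → (i == i) ≡ true
==-refl i with i ≟F i
... | yes _ = refl
... | no i≢i = ⊥-elim (i≢i refl)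

∀F-elim : ∀ {n} {p : Fin n → Bool} → ∀F p ≡ true → ∀ i → p i ≡ true
∀F-elim {n} {p} h i = go (allFin n) h (∈-allFin i)
  where
  go : ∀ xs → all p xs ≡ true → i ∈ xs → p i ≡ true
  go (x ∷ xs) h (here refl) = ∧-elimˡ h
  go (x ∷ xs) h (there i∈xs) = go xs (∧-elimʳ {p x} h) i∈xs

∀F-intro : ∀ {n} {p : Fin n → Bool} → (∀ i → p i ≡ true) → ∀F p ≡ true
∀F-intro {n} {p} h = go (allFin n)
  where
  go : ∀ xs → all p xs ≡ true
  go [] = refl
  go (x ∷ xs) = ∧-intro (h x) (go xs)

∀F-counterexample : ∀ {n} {p : Fin n → Bool} → ∀F p ≡ false → ∃ λ i → p i ≡ false
∀F-counterexample {n} {p} = go (allFin n)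
  where
  go : ∀ xs → all p xs ≡ false → ∃ λ i → p i ≡ false
  go (x ∷ xs) h with p x in px
  ... | false = x , px
  ... | true = go xs h

∃F-elim : ∀ {n} {p : Fin n → Bool} → ∃F p ≡ true → ∃ λ i → p i ≡ true
∃F-elim {n} {p} = go (allFin n)
  where
  go : ∀ xs → any p xs ≡ true → ∃ λ i → p i ≡ true
  go (x ∷ xs) h with p x in px
  ... | true = x , px
  ... | false = go xs h

∃F-intro : ∀ {n} {p : Fin n → Bool} i → p i ≡ true → ∃F p ≡ true
∃F-intro {n} {p} i h = go (allFin n) (∈-allFin i)
  where
  go : ∀ xs → i ∈ xs → any p xs ≡ true
  go (x ∷ xs) (here refl) = ∨-introˡ h
  go (x ∷ xs) (there i∈xs) = ∨-introʳ (p x) (go xs i∈xs)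

-- Counting

count : {A : Set} → (A → Bool) → List A → ℕ
count p xs = length (filter (λ x → p x Bool.≟ true) xs)

count-cong : ∀ {p q : A → Bool} xs → (∀ x → p x ≡ q x) → count p xs ≡ count q xs
count-cong {p = p} {q = q} [] _ = refl
count-cong {p = p} {q = q} (x ∷ xs) p≗q with p x | q x | p≗q x
... | true  | .true  | refl = cong suc (count-cong xs p≗q)
... | false | .false | refl = count-cong xs p≗q

count-++ : ∀ (p : A → Bool) xs ys → count p (xs ++ ys) ≡ count p xs + count p ys
count-++ p [] ys = refl
count-++ p (x ∷ xs) ys with p x
... | true  = cong suc (count-++ p xs ys)
... | false = count-++ p xs ys

count-map : ∀ (p : A → Bool) (f : B → A) xs → count p (map f xs) ≡ count (p ∘ f) xs
count-map p f [] = refl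
count-map p f (x ∷ xs) with p (f x)
... | true  = cong suc (count-map p f xs)
... | false = count-map p f xs

count-split : ∀ (p q : A → Bool) xs →
              count p xs ≡ count (λ x → p x ∧ q x) xs + count (λ x → p x ∧ not (q x)) xs
count-split p q [] = refl
count-split p q (x ∷ xs) with p x | q x
... | true  | true  = cong suc (count-split p q xs)
... | true  | false = trans (cong suc (count-split p q xs)) (sym (+-suc _ _))
... | false | _     = count-split p q xs

count≤length : ∀ (p : A → Bool) xs → count p xs ≤ length xs
count≤length p [] = z≤n
count≤length p (x ∷ xs) with p x
... | true  = s≤s (count≤length p xs)
... | false = m≤n⇒m≤1+n (count≤length p xs)

count-mono : ∀ {p q : A → Bool} → (∀ x → p x ≡ true → q x ≡ true) →
             ∀ xs → count p xs ≤ count q xs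
count-mono p⊆q [] = z≤n
count-mono {p = p} {q = q} p⊆q (x ∷ xs) with p x in px | q x in qx
... | true  | true  = s≤s (count-mono p⊆q xs)
... | true  | false with () ← trans (sym (p⊆q x px)) qx
... | false | true  = m≤n⇒m≤1+n (count-mono p⊆q xs)
... | false | false = count-mono p⊆q xs

count-strict : ∀ {p q : A → Bool} → (∀ x → p x ≡ true → q x ≡ true) →
               ∀ {y} xs → y ∈ xs → p y ≡ false → q y ≡ true → count p xs < count q xs
count-strict {p = p} {q = q} p⊆q (x ∷ xs) (here refl) py qy rewrite py | qy = s≤s (count-mono p⊆q xs)
count-strict {p = p} {q = q} p⊆q (x ∷ xs) (there y∈xs) py qy with p x in px | q x in qx
... | true  | true  = s≤s (count-strict p⊆q xs y∈xs py qy)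
... | true  | false with () ← trans (sym (p⊆q x px)) qx
... | false | true  = m≤n⇒m≤1+n (count-strict p⊆q xs y∈xs py qy)
... | false | false = count-strict p⊆q xs y∈xs py qy

count-cartesianProduct : ∀ (p : A × B → Bool) xs ys →
  count p (cartesianProduct xs ys) ≡ sum (map (λ x → count (λ y → p (x , y)) ys) xs)
count-cartesianProduct p [] ys = refl
count-cartesianProduct p (x ∷ xs) ys = begin
  count p (map (x ,_) ys ++ cartesianProduct xs ys)
    ≡⟨ count-++ p (map (x ,_) ys) (cartesianProduct xs ys) ⟩
  count p (map (x ,_) ys) + count p (cartesianProduct xs ys)
    ≡⟨ cong₂ _+_ (count-map p (x ,_) ys) (count-cartesianProduct p xs ys) ⟩
  count (λ y → p (x , y)) ys + sum (map (λ x → count (λ y → p (x , y)) ys) xs) ∎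
  where open ≡-Reasoning

sum-by-classes : ∀ (p q : A → Bool) (j k : ℕ) (w : A → ℕ) →
  (∀ x → w x ≡ (if p x then (if q x then j else k) else 0)) →
  ∀ xs → sum (map w xs) ≡ j * count (λ x → p x ∧ q x) xs + k * count (λ x → p x ∧ not (q x)) xs
sum-by-classes p q j k w w≡ [] = sym (cong₂ _+_ (*-zeroʳ j) (*-zeroʳ k))
sum-by-classes p q j k w w≡ (x ∷ xs) with p x | q x | w x | w≡ x
... | false | _     | _ | refl = sum-by-classes p q j k w w≡ xs
... | true  | true  | _ | refl =
  trans (cong (j +_) (sum-by-classes p q j k w w≡ xs)) (add-first j k _ _)
  where
  add-first : ∀ j k a b → j + (j * a + k * b) ≡ j * suc a + k * b
  add-first = solve-∀
... | true  | false | _ | refl =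
  trans (cong (k +_) (sum-by-classes p q j k w w≡ xs)) (add-second j k _ _)
  where
  add-second : ∀ j k a b → k + (j * a + k * b) ≡ j * a + k * suc b
  add-second = solve-∀

count-bijection : ∀ {xs : List A} {ys : List B} →
  Unique xs → Unique ys → (∀ x → x ∈ xs) → (∀ y → y ∈ ys) →
  (p : A → Bool) (q : B → Bool) (f : A → B) (g : B → A) →
  (∀ x → p x ≡ true → q (f x) ≡ true) → (∀ y → q y ≡ true → p (g y) ≡ true) →
  (∀ x → p x ≡ true → g (f x) ≡ x) → (∀ y → q y ≡ true → f (g y) ≡ y) →
  count p xs ≡ count q ys
count-bijection {xs = xs} {ys} xs! ys! xs-complete ys-complete p q f g pq qp gf fg = begin
  length ps              ≡⟨ length-map f ps ⟨
  length (map f ps)      ≡⟨ ↭-length (∼bag⇒↭ (unique∧set⇒bag f[ps]! qs! same-members)) ⟩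
  length qs              ∎
  where
  open ≡-Reasoning
  p? = λ x → p x Bool.≟ true
  q? = λ y → q y Bool.≟ true
  ps = filter p? xs
  qs = filter q? ys

  g∘f-on-ps : map g (map f ps) ≡ ps
  g∘f-on-ps = trans (sym (map-∘ ps)) (map-id-local (All.map (gf _) (all-filter p? xs)))

  f[ps]! : Unique (map f ps)
  f[ps]! = Unique.map⁻ (subst Unique (sym g∘f-on-ps) (Unique.filter⁺ p? xs!))

  qs! : Unique qs
  qs! = Unique.filter⁺ q? ys!

  same-members : ∀ {y} → y ∈ map f ps ⇔ y ∈ qs
  same-members = mk⇔ forth back
    where
    forth : ∀ {y} → y ∈ map f ps → y ∈ qs
    forth y∈ with ∈-map⁻ f y∈
    ... | x , x∈ps , refl = ∈-filter⁺ q? (ys-complete (f x)) (pq x (proj₂ (∈-filter⁻ p? {xs = xs} x∈ps)))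
    back : ∀ {y} → y ∈ qs → y ∈ map f ps
    back {y} y∈ with qy ← proj₂ (∈-filter⁻ q? {xs = ys} y∈) =
      subst (_∈ map f ps) (fg y qy) (∈-map⁺ f (∈-filter⁺ p? (xs-complete (g y)) (qp y qy)))

concatMap-map≡cartesianProductWith : ∀ (f : A → B → D) xs ys →
  concatMap (λ x → map (f x) ys) xs ≡ cartesianProductWith f xs ys
concatMap-map≡cartesianProductWith f [] ys = refl
concatMap-map≡cartesianProductWith f (x ∷ xs) ys =
  cong (map (f x) ys ++_) (concatMap-map≡cartesianProductWith f xs ys)

allVecs-unique : ∀ {xs : List A} k → Unique xs → Unique (allVecs xs k)
allVecs-unique zero xs! = [] ∷ []
allVecs-unique {xs = xs} (suc k) xs! =
  subst Unique (sym (concatMap-map≡cartesianProductWith _∷_ xs (allVecs xs k)))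
    (Unique.cartesianProductWith⁺ _∷_ ∷-injective xs! (allVecs-unique k xs!))

allVecs-complete : ∀ {xs : List A} k → (∀ x → x ∈ xs) → ∀ v → v ∈ allVecs xs k
allVecs-complete zero xs-complete [] = here refl
allVecs-complete {xs = xs} (suc k) xs-complete (x ∷ v) =
  subst ((x ∷ v) ∈_) (sym (concatMap-map≡cartesianProductWith _∷_ xs (allVecs xs k)))
    (∈-cartesianProductWith⁺ _∷_ (xs-complete x) (allVecs-complete k xs-complete v))

bools : List Bool
bools = true ∷ false ∷ []

bools-unique : Unique bools
bools-unique = ((λ ()) ∷ []) ∷ [] ∷ []

bools-complete : ∀ b → b ∈ bools
bools-complete true = here refl
bools-complete false = there (here refl)

allRels-unique : ∀ n → Unique (allRels n)
allRels-unique n = allVecs-unique n (allVecs-unique n bools-unique)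

allRels-complete : ∀ n R → R ∈ allRels n
allRels-complete n = allVecs-complete n (allVecs-complete n bools-complete)

-- Compositions

_⊢_∼_ : ∀ {n} → Rel n → Fin n → Fin n → Set
R ⊢ i ∼ j = rel R i j ≡ true

module _ {n} {R : Rel n} where

  isEquivalence-sound : isEquivalence R ≡ true → IsEquivalence (R ⊢_∼_)
  isEquivalence-sound h = record
    { refl  = λ {i} → ∀F-elim reflexive i
    ; sym   = λ {i} {j} → ⇒-elim (∀F-elim (∀F-elim symmetric i) j)
    ; trans = λ {i} {j} {k} i∼j j∼k →
        ⇒-elim (∀F-elim (∀F-elim (∀F-elim transitive i) j) k) (∧-intro i∼j j∼k)
    }
    where
    reflexive  = ∧-elimˡ h
    symmetric  = ∧-elimˡ (∧-elimʳ {∀F (λ i → rel R i i)} h)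
    transitive = ∧-elimʳ {∀F (λ i → ∀F (λ j → rel R i j ⇒ rel R j i))}
                   (∧-elimʳ {∀F (λ i → rel R i i)} h)

  isEquivalence-complete : IsEquivalence (R ⊢_∼_) → isEquivalence R ≡ true
  isEquivalence-complete e = ∧-intro reflexive (∧-intro symmetric transitive)
    where
    open IsEquivalence e using () renaming (refl to refl′; sym to sym′; trans to trans′)
    reflexive : ∀F (λ i → rel R i i) ≡ true
    reflexive = ∀F-intro {n} λ _ → refl′
    symmetric : ∀F (λ i → ∀F (λ j → rel R i j ⇒ rel R j i)) ≡ true
    symmetric = ∀F-intro {n} λ _ → ∀F-intro {n} λ _ → ⇒-intro sym′
    transitive : ∀F (λ i → ∀F (λ j → ∀F (λ k → (rel R i j ∧ rel R j k) ⇒ rel R i k))) ≡ true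
    transitive = ∀F-intro {n} λ _ → ∀F-intro {n} λ _ → ∀F-intro {n} λ _ →
                   ⇒-intro λ h → trans′ (∧-elimˡ h) (∧-elimʳ h)

  rel-symmetric : IsEquivalence (R ⊢_∼_) → ∀ i j → rel R i j ≡ rel R j i
  rel-symmetric e i j = true-ext (IsEquivalence.sym e) (IsEquivalence.sym e)

data Walk {m} (G : Graph m) (B : Fin m → Bool) (u : Fin m) : Fin m → Set where
  start : B u ≡ true → Walk G B u u
  step  : ∀ {w v} → Walk G B u w → adj G w v ≡ true → B v ≡ true → Walk G B u v

module _ {m} {G : Graph m} {B : Fin m → Bool} where

  walk-end : ∀ {u v} → Walk G B u v → B v ≡ true
  walk-end (start b) = b
  walk-end (step _ _ b) = b

  walk-++ : ∀ {u w v} → Walk G B u w → Walk G B w v → Walk G B u v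
  walk-++ p (start _) = p
  walk-++ p (step q a b) = step (walk-++ p q) a b

  walk-reverse : (∀ x y → adj G x y ≡ true → adj G y x ≡ true) →
                 ∀ {u v} → Walk G B u v → Walk G B v u
  walk-reverse adj-sym (start b) = start b
  walk-reverse adj-sym (step p a b) =
    walk-++ (step (start b) (adj-sym _ _ a) (walk-end p)) (walk-reverse adj-sym p)

walk-map : ∀ {m} {G : Graph m} {B B′ : Fin m → Bool} → (∀ z → B z ≡ true → B′ z ≡ true) →
           ∀ {u v} → Walk G B u v → Walk G B′ u v
walk-map f (start b) = start (f _ b)
walk-map f (step p a b) = step (walk-map f p) a (f _ b)

Stalls : ∀ {m} → (ℕ → Fin m → Bool) → ℕ → Set
Stalls r s = ∀ v → r (suc s) v ≡ true → r s v ≡ true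

-- Every step of an ascending chain of subsets of Fin m that does not stall adds an element,
-- so the chain stalls within m steps, and from then on it is constant since stalls persist.
module AscendingChain {m} (r : ℕ → Fin m → Bool)
  (r-inflationary : ∀ s v → r s v ≡ true → r (suc s) v ≡ true)
  (stalls-suc : ∀ s → Stalls r s → Stalls r (suc s)) where

  r-mono : ∀ k s v → r s v ≡ true → r (k + s) v ≡ true
  r-mono zero s v h = h
  r-mono (suc k) s v h = r-inflationary (k + s) v (r-mono k s v h)

  stalls-+ : ∀ {s} → Stalls r s → ∀ k → Stalls r (k + s)
  stalls-+ st zero = st
  stalls-+ {s} st (suc k) = stalls-suc (k + s) (stalls-+ st k)

  stalled : ∀ {s} → Stalls r s → ∀ k v → r (k + s) v ≡ true → r s v ≡ true
  stalled st zero v h = h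
  stalled st (suc k) v h = stalled st k v (stalls-+ st k v h)

  size : ℕ → ℕ
  size s = count (r s) (allFin m)

  stalls-or-grows : ∀ s → (∃[ s′ ] s′ < s × Stalls r s′) ⊎ s ≤ size s
  stalls-or-grows zero = inj₂ z≤n
  stalls-or-grows (suc s) with stalls-or-grows s
  ... | inj₁ (s′ , s′<s , st) = inj₁ (s′ , m≤n⇒m≤1+n s′<s , st)
  ... | inj₂ s≤size with ∀F (λ v → r (suc s) v ⇒ r s v) in stall?
  ... | true = inj₁ (s , ≤-refl , λ v → ⇒-elim (∀F-elim stall? v))
  ... | false with ∀F-counterexample stall?
  ... | v , new-v with ⇒-counterexample new-v
  ... | reached , not-yet = inj₂ (≤-trans (s≤s s≤size)
          (count-strict (r-inflationary s) (allFin m) (∈-allFin v) not-yet reached))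

  stalls-within : ∃[ s ] s ≤ m × Stalls r s
  stalls-within with stalls-or-grows (suc m)
  ... | inj₁ (s , s≤s s≤m , st) = s , s≤m , st
  ... | inj₂ m<size = ⊥-elim (<⇒≱ m<size
          (≤-trans (count≤length (r (suc m)) (allFin m)) (≤-reflexive (length-tabulate id))))

  stabilises : ∀ s v → r s v ≡ true → r m v ≡ true
  stabilises t v h with stalls-within
  ... | s , s≤m , st with m≤n⇒∃[o]m+o≡n s≤m
  ... | o , refl = subst (λ k → r k v ≡ true) (+-comm o s)
        (r-mono o s v (stalled st t v (subst (λ k → r k v ≡ true) (+-comm s t) (r-mono s t v h))))

module _ {m} (G : Graph m) (R : Rel m) where

  reachWithin⇒walk : ∀ s {u v} → reachWithin G R s u v ≡ true → Walk G (rel R u) u v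
  reachWithin⇒walk zero {u} {v} h with refl ← ==⇒≡ {i = u} {v} (∧-elimˡ h) = start (∧-elimʳ {u == u} h)
  reachWithin⇒walk (suc s) {u} {v} h with ∨-elim h
  ... | inj₁ h′ = reachWithin⇒walk s h′
  ... | inj₂ h′ with w , via-w ← ∃F-elim h′ =
    step (reachWithin⇒walk s (∧-elimˡ via-w)) (∧-elimˡ adj∧rel) (∧-elimʳ adj∧rel)
    where adj∧rel = ∧-elimʳ {reachWithin G R s u w} via-w

  walk⇒reachWithin : ∀ {u v} → Walk G (rel R u) u v → ∃[ s ] reachWithin G R s u v ≡ true
  walk⇒reachWithin {u} (start b) = zero , ∧-intro (==-refl u) b
  walk⇒reachWithin {u} {v} (step {w} p a b) with s , h ← walk⇒reachWithin p =
    suc s , ∨-introʳ (reachWithin G R s u v) (∃F-intro w (∧-intro h (∧-intro a b)))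

  reachWithin-stabilises : ∀ {u} s v → reachWithin G R s u v ≡ true → reachWithin G R m u v ≡ true
  reachWithin-stabilises {u} = AscendingChain.stabilises (λ s → reachWithin G R s u)
    (λ _ _ → ∨-introˡ) stalls-suc
    where
    stalls-suc : ∀ s → Stalls (λ s → reachWithin G R s u) s →
                 Stalls (λ s → reachWithin G R s u) (suc s)
    stalls-suc s st v h with ∨-elim h
    ... | inj₁ h′ = h′
    ... | inj₂ h′ with w , via-w ← ∃F-elim h′ =
      ∨-introʳ (reachWithin G R s u v)
        (∃F-intro w (∧-intro (st w (∧-elimˡ via-w)) (∧-elimʳ {reachWithin G R (suc s) u w} via-w)))

record IsComposition {m} (G : Graph m) (R : Rel m) : Set where
  field
    equivalence : IsEquivalence (R ⊢_∼_)
    connected   : ∀ {u v} → R ⊢ u ∼ v → Walk G (rel R u) u v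

module _ {m} {G : Graph m} {R : Rel m} where

  isComposition-sound : isComposition G R ≡ true → IsComposition G R
  isComposition-sound h = record
    { equivalence = isEquivalence-sound {R = R} (∧-elimˡ h)
    ; connected = λ {u} {v} u∼v →
        reachWithin⇒walk G R m (⇒-elim (∀F-elim (∀F-elim (∧-elimʳ {isEquivalence R} h) u) v) u∼v)
    }

  isComposition-complete : IsComposition G R → isComposition G R ≡ true
  isComposition-complete c = ∧-intro (isEquivalence-complete {R = R} (IsComposition.equivalence c))
    (∀F-intro {m} λ u → ∀F-intro {m} λ v → ⇒-intro λ u∼v →
      let s , h = walk⇒reachWithin G R (IsComposition.connected c u∼v)
      in reachWithin-stabilises G R s v h)

relation : ∀ {n} → (Fin n → Fin n → Bool) → Rel n
relation f = tabulate λ x → tabulate λ y → f x y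

rel-relation : ∀ {n} (f : Fin n → Fin n → Bool) x y → rel (relation f) x y ≡ f x y
rel-relation f x y = trans (cong (λ row → lookup row y) (lookup∘tabulate _ x)) (lookup∘tabulate _ y)

rel-extensional : ∀ {n} {R S : Rel n} → (∀ x y → rel R x y ≡ rel S x y) → R ≡ S
rel-extensional {R = R} {S} R≗S = begin
  R                                            ≡⟨ tabulate∘lookup R ⟨
  tabulate (λ x → lookup R x)                  ≡⟨ tabulate-cong row ⟩
  tabulate (λ x → lookup S x)                  ≡⟨ tabulate∘lookup S ⟩
  S                                            ∎
  where
  open ≡-Reasoning
  row : ∀ x → lookup R x ≡ lookup S x
  row x = trans (sym (tabulate∘lookup (lookup R x)))
            (trans (tabulate-cong (R≗S x)) (tabulate∘lookup (lookup S x)))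

pullback-isEquivalence : ∀ {n} {A : Set} (E : A → A → Bool) (f : Fin n → A) →
  IsEquivalence (λ a b → E a b ≡ true) →
  IsEquivalence (relation (λ x y → E (f x) (f y)) ⊢_∼_)
pullback-isEquivalence E f e = record
  { refl  = λ {x} → trans (rel-relation F x x) (IsEquivalence.refl e)
  ; sym   = λ {x} {y} h → trans (rel-relation F y x) (IsEquivalence.sym e (via x y h))
  ; trans = λ {x} {y} {z} h k → trans (rel-relation F x z) (IsEquivalence.trans e (via x y h) (via y z k))
  }
  where
  F = λ x y → E (f x) (f y)
  via : ∀ x y → rel (relation F) x y ≡ true → E (f x) (f y) ≡ true
  via x y h = trans (sym (rel-relation F x y)) h

-- The blocks of R together with two fresh blocks, which are merged when φ holds.
withFresh : ∀ {m} → Rel m → Bool → Fin m ⊎ Fin 2 → Fin m ⊎ Fin 2 → Bool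
withFresh R φ (inj₁ x) (inj₁ y) = rel R x y
withFresh R φ (inj₂ r) (inj₂ r′) = (r == r′) ∨ φ
withFresh R φ (inj₁ _) (inj₂ _) = false
withFresh R φ (inj₂ _) (inj₁ _) = false

withFresh-isEquivalence : ∀ {m} {R : Rel m} φ → IsEquivalence (R ⊢_∼_) →
  IsEquivalence (λ a b → withFresh R φ a b ≡ true)
withFresh-isEquivalence {R = R} φ e = record
  { refl = λ {a} → refl′ a ; sym = λ {a} {b} → sym′ a b ; trans = λ {a} {b} {c} → trans′ a b c }
  where
  open IsEquivalence e using () renaming (refl to reflR; sym to symR; trans to transR)
  refl′ : ∀ a → withFresh R φ a a ≡ true
  refl′ (inj₁ x) = reflR
  refl′ (inj₂ r) = ∨-introˡ (==-refl r)
  sym′ : ∀ a b → withFresh R φ a b ≡ true → withFresh R φ b a ≡ true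
  sym′ (inj₁ x) (inj₁ y) h = symR h
  sym′ (inj₂ r) (inj₂ r′) h with ∨-elim h
  ... | inj₁ r==r′ with refl ← ==⇒≡ {i = r} {r′} r==r′ = h
  ... | inj₂ φ-holds = ∨-introʳ (r′ == r) φ-holds
  trans′ : ∀ a b c → withFresh R φ a b ≡ true → withFresh R φ b c ≡ true → withFresh R φ a c ≡ true
  trans′ (inj₁ x) (inj₁ y) (inj₁ z) h k = transR h k
  trans′ (inj₂ r) (inj₂ r′) (inj₂ r″) h k with ∨-elim h | ∨-elim k
  ... | inj₂ φ-holds | _ = ∨-introʳ (r == r″) φ-holds
  ... | inj₁ _ | inj₂ φ-holds = ∨-introʳ (r == r″) φ-holds
  ... | inj₁ r==r′ | inj₁ r′==r″ with refl ← ==⇒≡ {i = r} {r′} r==r′ | refl ← ==⇒≡ {i = r′} {r″} r′==r″ = h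

-- Attaching a rung

other : Fin 2 → Fin 2
other zero = suc zero
other (suc zero) = zero

other-involutive : ∀ r → other (other r) ≡ r
other-involutive zero = refl
other-involutive (suc zero) = refl

same-or-other : ∀ r e → e ≡ r ⊎ e ≡ other r
same-or-other zero zero = inj₁ refl
same-or-other zero (suc zero) = inj₂ refl
same-or-other (suc zero) zero = inj₂ refl
same-or-other (suc zero) (suc zero) = inj₁ refl

-- G′ is G with a new rung new 0 — new 1 whose ends are joined to the adjacent vertices end 0, end 1.
record RungExtension {m m′} (G : Graph m) (G′ : Graph m′) : Set where
  field
    old    : Fin m → Fin m′
    new    : Fin 2 → Fin m′
    end    : Fin 2 → Fin m
    origin : Fin m′ → Fin m ⊎ Fin 2
    origin-old     : ∀ x → origin (old x) ≡ inj₁ x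
    origin-new     : ∀ r → origin (new r) ≡ inj₂ r
    origin-section : ∀ z → [ old , new ] (origin z) ≡ z
    adj-old-old    : ∀ x y → adj G′ (old x) (old y) ≡ adj G x y
    adj-old-new    : ∀ x r → adj G′ (old x) (new r) ≡ true → x ≡ end r
    adj-end-new    : ∀ r → adj G′ (old (end r)) (new r) ≡ true
    adj-new-new    : ∀ r → adj G′ (new r) (new (other r)) ≡ true
    adj-end-end    : ∀ r → adj G (end r) (end (other r)) ≡ true
    adj′-sym       : ∀ x y → adj G′ x y ≡ true → adj G′ y x ≡ true

-- attached t r: new r lies in the block of end r; rungJoined t: new 0 and new 1 share a block.
RungState : Set
RungState = Bool × Bool × Bool

attached : RungState → Fin 2 → Bool
attached (a , _ , _) zero = a
attached (_ , b , _) (suc zero) = b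

rungJoined : RungState → Bool
rungJoined (_ , _ , f) = f

-- end 0, new 0, new 1, end 1 form a 4-cycle whose links are a, f, b and s (ends joined);
-- a state is consistent iff no three of these links hold without the fourth.
consistent : Bool → RungState → Bool
consistent s (a , b , f) =
  ((s ∧ a ∧ f) ⇒ b) ∧ ((s ∧ b ∧ f) ⇒ a) ∧ ((a ∧ b ∧ f) ⇒ s) ∧ ((s ∧ a ∧ b) ⇒ f)

consistent-intro : ∀ {s a b f} →
  (s ∧ a ∧ f ≡ true → b ≡ true) → (s ∧ b ∧ f ≡ true → a ≡ true) →
  (a ∧ b ∧ f ≡ true → s ≡ true) → (s ∧ a ∧ b ≡ true → f ≡ true) →
  consistent s (a , b , f) ≡ true
consistent-intro h₁ h₂ h₃ h₄ =
  ∧-intro (⇒-intro h₁) (∧-intro (⇒-intro h₂) (∧-intro (⇒-intro h₃) (⇒-intro h₄)))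

consistent-both-attached : ∀ {s} t → consistent s t ≡ true →
  attached t zero ≡ true → attached t (suc zero) ≡ true → rungJoined t ≡ s
consistent-both-attached {true}  (.true , .true , true)  _  refl refl = refl
consistent-both-attached {true}  (.true , .true , false) () refl refl
consistent-both-attached {false} (.true , .true , true)  () refl refl
consistent-both-attached {false} (.true , .true , false) _  refl refl = refl

consistent-one-attached : ∀ {s} t r → consistent s t ≡ true → rungJoined t ≡ true →
  attached t r ≡ false → attached t (other r) ≡ true → s ≡ false
consistent-one-attached {false} _ _ _ _ _ _ = refl
consistent-one-attached {true} (.false , .true , .true) zero       () refl refl refl
consistent-one-attached {true} (.true , .false , .true) (suc zero) () refl refl refl

rungState-extensional : ∀ {t t′} → (∀ r → attached t r ≡ attached t′ r) → rungJoined t ≡ rungJoined t′ → t ≡ t′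
rungState-extensional {_ , _ , _} {_ , _ , _} same-attached refl
  rewrite same-attached zero | same-attached (suc zero) = refl

rungStates : List RungState
rungStates = cartesianProduct bools (cartesianProduct bools bools)

rungStates-unique : Unique rungStates
rungStates-unique = Unique.cartesianProduct⁺ bools-unique (Unique.cartesianProduct⁺ bools-unique bools-unique)

rungStates-complete : ∀ t → t ∈ rungStates
rungStates-complete (a , b , f) =
  ∈-cartesianProduct⁺ (bools-complete a) (∈-cartesianProduct⁺ (bools-complete b) (bools-complete f))

module RungExtensionProperties {m m′} {G : Graph m} {G′ : Graph m′} (X : RungExtension G G′) where
  open RungExtension X

  vertex-cases : (P : Fin m′ → Set) → (∀ x → P (old x)) → (∀ r → P (new r)) → ∀ z → P z
  vertex-cases P P-old P-new z with origin z | origin-section z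
  ... | inj₁ x | refl = P-old x
  ... | inj₂ r | refl = P-new r

  old-injective : ∀ {x y} → old x ≡ old y → x ≡ y
  old-injective {x} {y} eq = inj₁-injective (trans (sym (origin-old x)) (trans (cong origin eq) (origin-old y)))

  old≢new : ∀ {x r} → old x ≢ new r
  old≢new {x} {r} eq with () ← trans (sym (origin-old x)) (trans (cong origin eq) (origin-new r))

  adj-new-old : ∀ r x → adj G′ (new r) (old x) ≡ true → x ≡ end r
  adj-new-old r x a = adj-old-new x r (adj′-sym _ _ a)

  endsJoined : Rel m → Bool
  endsJoined R = rel R (end zero) (end (suc zero))

  endsJoined-other : ∀ {R} → IsEquivalence (R ⊢_∼_) → ∀ r → rel R (end r) (end (other r)) ≡ endsJoined R
  endsJoined-other e zero = refl
  endsJoined-other {R} e (suc zero) = rel-symmetric {R = R} e _ _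

  restrict : Rel m′ → Rel m
  restrict R′ = relation λ x y → rel R′ (old x) (old y)

  rungState : Rel m′ → RungState
  rungState R′ = rel R′ (new zero) (old (end zero)) , rel R′ (new (suc zero)) (old (end (suc zero))) ,
                 rel R′ (new zero) (new (suc zero))

  attached-rungState : ∀ R′ r → attached (rungState R′) r ≡ rel R′ (new r) (old (end r))
  attached-rungState R′ zero = refl
  attached-rungState R′ (suc zero) = refl

  rungJoined-rungState : ∀ R′ → IsEquivalence (R′ ⊢_∼_) → ∀ r →
                         rungJoined (rungState R′) ≡ rel R′ (new r) (new (other r))
  rungJoined-rungState R′ e zero = refl
  rungJoined-rungState R′ e (suc zero) = rel-symmetric {R = R′} e _ _

  -- Where new r goes: the block of end r, that of end (other r) through the rung, or a fresh block.
  anchor : RungState → Fin 2 → Fin m ⊎ Fin 2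
  anchor t r with attached t r | rungJoined t ∧ attached t (other r)
  ... | true  | _     = inj₁ (end r)
  ... | false | true  = inj₁ (end (other r))
  ... | false | false = inj₂ r

  data AnchorView (t : RungState) (r : Fin 2) : Fin m ⊎ Fin 2 → Set where
    own      : attached t r ≡ true → AnchorView t r (inj₁ (end r))
    via-rung : attached t r ≡ false → rungJoined t ≡ true → attached t (other r) ≡ true →
               AnchorView t r (inj₁ (end (other r)))
    fresh    : attached t r ≡ false → rungJoined t ∧ attached t (other r) ≡ false →
               AnchorView t r (inj₂ r)

  anchor-view : ∀ t r → AnchorView t r (anchor t r)
  anchor-view t r with attached t r in a | rungJoined t ∧ attached t (other r) in j
  ... | true  | _     = own a
  ... | false | true  = via-rung a (∧-elimˡ j) (∧-elimʳ {rungJoined t} j)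
  ... | false | false = fresh a j

  place : RungState → Fin m′ → Fin m ⊎ Fin 2
  place t z = [ inj₁ , anchor t ] (origin z)

  anchor-attached : ∀ t r → attached t r ≡ true → anchor t r ≡ inj₁ (end r)
  anchor-attached t r a rewrite a = refl

  extend : Rel m → RungState → Rel m′
  extend R t = relation λ x y → withFresh R (rungJoined t) (place t x) (place t y)

  module _ (R : Rel m) (t : RungState) where

    extend-via-origin : ∀ {x y a b} → origin x ≡ a → origin y ≡ b →
                        rel (extend R t) x y ≡ withFresh R (rungJoined t) ([ inj₁ , anchor t ] a) ([ inj₁ , anchor t ] b)
    extend-via-origin {x} {y} ox oy = trans (rel-relation _ x y)
      (cong₂ (λ a b → withFresh R (rungJoined t) ([ inj₁ , anchor t ] a) ([ inj₁ , anchor t ] b)) ox oy)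

    extend-old-old : ∀ x y → rel (extend R t) (old x) (old y) ≡ rel R x y
    extend-old-old x y = extend-via-origin (origin-old x) (origin-old y)

    extend-new-old : ∀ r y → rel (extend R t) (new r) (old y) ≡ withFresh R (rungJoined t) (anchor t r) (inj₁ y)
    extend-new-old r y = extend-via-origin (origin-new r) (origin-old y)

    extend-old-new : ∀ x r → rel (extend R t) (old x) (new r) ≡ withFresh R (rungJoined t) (inj₁ x) (anchor t r)
    extend-old-new x r = extend-via-origin (origin-old x) (origin-new r)

    extend-new-new : ∀ r r′ → rel (extend R t) (new r) (new r′) ≡
                     withFresh R (rungJoined t) (anchor t r) (anchor t r′)
    extend-new-new r r′ = extend-via-origin (origin-new r) (origin-new r′)

    restrict-extend : restrict (extend R t) ≡ R
    restrict-extend = rel-extensional λ x y → trans (rel-relation _ x y) (extend-old-old x y)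

    module _ (e : IsEquivalence (R ⊢_∼_)) where
      open IsEquivalence e using () renaming (refl to reflR)

      extend-isEquivalence : IsEquivalence (extend R t ⊢_∼_)
      extend-isEquivalence = pullback-isEquivalence _ (place t) (withFresh-isEquivalence (rungJoined t) e)

      module _ (c : consistent (endsJoined R) t ≡ true) where

        extend-attached : ∀ r → rel (extend R t) (new r) (old (end r)) ≡ attached t r
        extend-attached r = trans (extend-new-old r (end r)) (by-view (anchor-view t r))
          where
          by-view : ∀ {a} → AnchorView t r a → withFresh R (rungJoined t) a (inj₁ (end r)) ≡ attached t r
          by-view (own a) = trans reflR (sym a)
          by-view (via-rung a j o) = begin
            rel R (end (other r)) (end r)   ≡⟨ rel-symmetric {R = R} e _ _ ⟩
            rel R (end r) (end (other r))   ≡⟨ endsJoined-other {R} e r ⟩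
            endsJoined R                    ≡⟨ consistent-one-attached t r c j a o ⟩
            false                           ≡⟨ a ⟨
            attached t r                    ∎
            where open ≡-Reasoning
          by-view (fresh a _) = sym a

        extend-rung-zero : rel (extend R t) (new zero) (new (suc zero)) ≡ rungJoined t
        extend-rung-zero = trans (extend-new-new zero (suc zero))
          (by-view (anchor-view t zero) (anchor-view t (suc zero)))
          where
          by-view : ∀ {a b} → AnchorView t zero a → AnchorView t (suc zero) b →
                    withFresh R (rungJoined t) a b ≡ rungJoined t
          by-view (own a₀) (own a₁) = sym (consistent-both-attached t c a₀ a₁)
          by-view (own a₀) (via-rung _ j _) = trans reflR (sym j)
          by-view (own a₀) (fresh _ j∧a₀) = sym (∧-false-elimˡ j∧a₀ a₀)
          by-view (via-rung _ j _) (own _) = trans reflR (sym j)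
          by-view (via-rung _ _ a₁) (via-rung ¬a₁ _ _) with () ← trans (sym a₁) ¬a₁
          by-view (via-rung _ _ a₁) (fresh ¬a₁ _) with () ← trans (sym a₁) ¬a₁
          by-view (fresh _ j∧a₁) (own a₁) = sym (∧-false-elimˡ j∧a₁ a₁)
          by-view (fresh ¬a₀ _) (via-rung _ _ a₀) with () ← trans (sym a₀) ¬a₀
          by-view (fresh _ _) (fresh _ _) = refl

        extend-rung : ∀ r → rel (extend R t) (new r) (new (other r)) ≡ rungJoined t
        extend-rung zero = extend-rung-zero
        extend-rung (suc zero) = trans (rel-symmetric {R = extend R t} extend-isEquivalence _ _) extend-rung-zero

        rungState-extend : rungState (extend R t) ≡ t
        rungState-extend = rungState-extensional
          (λ r → trans (attached-rungState (extend R t) r) (extend-attached r)) extend-rung-zero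

  module _ {R : Rel m} {t : RungState} (cR : IsComposition G R) (c : consistent (endsJoined R) t ≡ true) where
    private
      R′ = extend R t
      eR′ = extend-isEquivalence R t (IsComposition.equivalence cR)
      open IsEquivalence eR′ using () renaming (refl to reflR′; sym to symR′; trans to transR′)

    lift-walk : ∀ {x y} → Walk G (rel R x) x y → Walk G′ (rel R′ (old x)) (old x) (old y)
    lift-walk (start b) = start (trans (extend-old-old R t _ _) b)
    lift-walk (step p a b) = step (lift-walk p) (trans (adj-old-old _ _) a) (trans (extend-old-old R t _ _) b)

    walk-old-new : ∀ x r → R′ ⊢ old x ∼ new r → Walk G′ (rel R′ (old x)) (old x) (new r)
    walk-old-new x r h = by-view (anchor-view t r) (trans (sym (extend-old-new R t x r)) h)
      where
      to-end : ∀ {e} → rel R x e ≡ true → Walk G′ (rel R′ (old x)) (old x) (old e)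
      to-end x∼e = lift-walk (IsComposition.connected cR x∼e)
      by-view : ∀ {a} → AnchorView t r a → withFresh R (rungJoined t) (inj₁ x) a ≡ true →
                Walk G′ (rel R′ (old x)) (old x) (new r)
      by-view (own _) x∼e = step (to-end x∼e) (adj-end-new r) h
      by-view (via-rung _ _ o) x∼e = step (step (to-end x∼e) (adj-end-new (other r)) x∼new-o) rung h
        where
        x∼new-o : R′ ⊢ old x ∼ new (other r)
        x∼new-o = trans (extend-old-new R t x (other r))
                    (trans (cong (withFresh R (rungJoined t) (inj₁ x)) (anchor-attached t (other r) o)) x∼e)
        rung : adj G′ (new (other r)) (new r) ≡ true
        rung = subst (λ r′ → adj G′ (new (other r)) (new r′) ≡ true) (other-involutive r) (adj-new-new (other r))

    walk-new : ∀ r z → R′ ⊢ new r ∼ z → Walk G′ (rel R′ (new r)) (new r) z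
    walk-new r = vertex-cases _
      (λ y h → walk-map (λ _ → transR′ h)
                 (walk-reverse adj′-sym (walk-old-new y r (symR′ h))))
      (λ r′ h → case-rung r′ h (same-or-other r r′))
      where
      case-rung : ∀ r′ → R′ ⊢ new r ∼ new r′ → r′ ≡ r ⊎ r′ ≡ other r → Walk G′ (rel R′ (new r)) (new r) (new r′)
      case-rung r′ h (inj₁ refl) = start reflR′
      case-rung r′ h (inj₂ refl) = step (start reflR′) (adj-new-new r) h

    extend-isComposition : IsComposition G′ R′
    extend-isComposition = record
      { equivalence = eR′
      ; connected = λ {u} {v} → vertex-cases (λ u → ∀ v → R′ ⊢ u ∼ v → Walk G′ (rel R′ u) u v)
          (λ x → vertex-cases _
             (λ y h → lift-walk (IsComposition.connected cR (trans (sym (extend-old-old R t x y)) h)))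
             (walk-old-new x))
          walk-new u v
      }

  module _ {R′ : Rel m′} (cR′ : IsComposition G′ R′) where
    private
      R = restrict R′
      eR′ = IsComposition.equivalence cR′
      open IsEquivalence eR′ using () renaming (refl to reflR′; sym to symR′; trans to transR′)

    restrict-at : ∀ x y → rel R x y ≡ rel R′ (old x) (old y)
    restrict-at = rel-relation _

    restrict-isEquivalence : IsEquivalence (R ⊢_∼_)
    restrict-isEquivalence = pullback-isEquivalence (rel R′) old eR′

    -- What a walk in G′ from old u to z leaves in G: a walk to z itself if z is old,
    -- and otherwise a walk to the end of a new vertex in the block of old u.
    record Projection (u : Fin m) (z : Fin m′) : Set where
      field
        at-old : ∀ {y} → z ≡ old y → Walk G (rel R u) u y
        at-new : ∀ {r} → z ≡ new r → ∃[ r₀ ] Walk G (rel R u) u (end r₀) × R′ ⊢ old u ∼ new r₀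

    projection-step : ∀ u w z → Projection u w → adj G′ w z ≡ true → R′ ⊢ old u ∼ z → Projection u z
    projection-step u = vertex-cases _ from-old from-new
      where
      from-old : ∀ x z → Projection u (old x) → adj G′ (old x) z ≡ true → R′ ⊢ old u ∼ z → Projection u z
      from-old x z π a u∼z = record
        { at-old = λ { refl → step (Projection.at-old π refl) (trans (sym (adj-old-old _ _)) a)
                                    (trans (restrict-at _ _) u∼z) }
        ; at-new = λ { {r} refl → r , subst (Walk G (rel R u) u) (adj-old-new x r a) (Projection.at-old π refl) , u∼z }
        }
      from-new : ∀ r z → Projection u (new r) → adj G′ (new r) z ≡ true → R′ ⊢ old u ∼ z → Projection u z
      from-new r z π a u∼z = record
        { at-old = λ { {y} refl → to-end y (adj-new-old r y a) (Projection.at-new π refl) u∼z }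
        ; at-new = λ { refl → Projection.at-new π refl }
        }
        where
        to-end : ∀ y → y ≡ end r → ∃[ r₀ ] Walk G (rel R u) u (end r₀) × R′ ⊢ old u ∼ new r₀ →
                 R′ ⊢ old u ∼ old y → Walk G (rel R u) u y
        to-end y refl (r₀ , p , _) u∼y with same-or-other r r₀
        ... | inj₁ refl = p
        ... | inj₂ refl = step p
                (subst (λ r′ → adj G (end (other r)) (end r′) ≡ true) (other-involutive r) (adj-end-end (other r)))
                (trans (restrict-at _ _) u∼y)

    projection : ∀ u {z} → Walk G′ (rel R′ (old u)) (old u) z → Projection u z
    projection u (start _) = record
      { at-old = λ eq → subst (Walk G (rel R u) u) (old-injective eq)
                           (start (trans (restrict-at u u) reflR′))
      ; at-new = λ eq → ⊥-elim (old≢new eq)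
      }
    projection u (step p a b) = projection-step u _ _ (projection u p) a b

    restrict-isComposition : IsComposition G R
    restrict-isComposition = record
      { equivalence = restrict-isEquivalence
      ; connected = λ {u} {v} u∼v →
          Projection.at-old (projection u (IsComposition.connected cR′ (trans (sym (restrict-at u v)) u∼v))) refl
      }

    block-entry : ∀ y r → R′ ⊢ old y ∼ new r → ∃[ r₀ ] R ⊢ y ∼ end r₀ × R′ ⊢ old y ∼ new r₀
    block-entry y r h with r₀ , p , y∼new ← Projection.at-new (projection y (IsComposition.connected cR′ h)) refl =
      r₀ , walk-end p , y∼new

    rungState-consistent : consistent (endsJoined R) (rungState R′) ≡ true
    rungState-consistent = consistent-intro
      (λ h → let s , a , f = ∧₃-elim h in transR′ (symR′ f) (transR′ a (ends s)))
      (λ h → let s , b , f = ∧₃-elim h in transR′ f (transR′ b (symR′ (ends s))))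
      (λ h → let a , b , f = ∧₃-elim h in trans (restrict-at _ _) (transR′ (symR′ a) (transR′ f b)))
      (λ h → let s , a , b = ∧₃-elim h in transR′ a (transR′ (ends s) (symR′ b)))
      where
      ends : R ⊢ end zero ∼ end (suc zero) → R′ ⊢ old (end zero) ∼ old (end (suc zero))
      ends s = trans (sym (restrict-at _ _)) s

    private
      t = rungState R′
      attached-at : ∀ {r} → attached t r ≡ true → R′ ⊢ new r ∼ old (end r)
      attached-at {r} a = trans (sym (attached-rungState R′ r)) a
      at-attached : ∀ {r} → R′ ⊢ new r ∼ old (end r) → attached t r ≡ true
      at-attached {r} h = trans (attached-rungState R′ r) h
      rung-at : ∀ {r} → rungJoined t ≡ true → R′ ⊢ new r ∼ new (other r)
      rung-at {r} j = trans (sym (rungJoined-rungState R′ eR′ r)) j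
      at-rung : ∀ {r} → R′ ⊢ new r ∼ new (other r) → rungJoined t ≡ true
      at-rung {r} h = trans (rungJoined-rungState R′ eR′ r) h
      restrict-old : ∀ {x y} → R ⊢ x ∼ y → R′ ⊢ old x ∼ old y
      restrict-old h = trans (sym (restrict-at _ _)) h
      old-restrict : ∀ {x y} → R′ ⊢ old x ∼ old y → R ⊢ x ∼ y
      old-restrict h = trans (restrict-at _ _) h

    extend-restrict-new-old : ∀ r y → rel (extend R t) (new r) (old y) ≡ rel R′ (new r) (old y)
    extend-restrict-new-old r y = trans (extend-new-old R t r y) (true-ext (forth (anchor-view t r)) back)
      where
      forth : ∀ {a} → AnchorView t r a → withFresh R (rungJoined t) a (inj₁ y) ≡ true → R′ ⊢ new r ∼ old y
      forth (own a) e∼y = transR′ (attached-at a) (restrict-old e∼y)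
      forth (via-rung _ j o) e∼y = transR′ (rung-at j) (transR′ (attached-at o) (restrict-old e∼y))

      back : R′ ⊢ new r ∼ old y → withFresh R (rungJoined t) (anchor t r) (inj₁ y) ≡ true
      back h with r₀ , y∼end , y∼new ← block-entry y r (symR′ h) | same-or-other r r₀
      ... | inj₁ refl = subst (λ a → withFresh R (rungJoined t) a (inj₁ y) ≡ true)
                          (sym (anchor-attached t r (at-attached (transR′ h (restrict-old y∼end)))))
                          (old-restrict (symR′ (restrict-old y∼end)))
      ... | inj₂ refl = by-view (anchor-view t r)
        where
        attached-other : attached t (other r) ≡ true
        attached-other = at-attached (transR′ (symR′ y∼new) (restrict-old y∼end))
        joined : rungJoined t ≡ true
        joined = at-rung (transR′ h y∼new)
        by-view : ∀ {a} → AnchorView t r a → withFresh R (rungJoined t) a (inj₁ y) ≡ true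
        by-view (own a) = old-restrict (transR′ (symR′ (attached-at a)) h)
        by-view (via-rung _ _ _) = old-restrict (symR′ (restrict-old y∼end))
        by-view (fresh _ j∧o) with () ← trans (sym j∧o) (∧-intro joined attached-other)

    extend-restrict : extend R t ≡ R′
    extend-restrict = rel-extensional (vertex-cases _
      (λ x → vertex-cases _
         (λ y → trans (extend-old-old R t x y) (restrict-at x y))
         (λ r → trans (rel-symmetric {R = extend R t} eR _ _)
                  (trans (extend-restrict-new-old r x) (rel-symmetric {R = R′} eR′ _ _))))
      (λ r → vertex-cases _ (extend-restrict-new-old r) (λ r′ → new-new r′ (same-or-other r r′))))
      where
      eR = extend-isEquivalence R t restrict-isEquivalence
      new-new : ∀ {r} r′ → r′ ≡ r ⊎ r′ ≡ other r → rel (extend R t) (new r) (new r′) ≡ rel R′ (new r) (new r′)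
      new-new _ (inj₁ refl) = trans (IsEquivalence.refl eR) (sym reflR′)
      new-new {r} _ (inj₂ refl) = trans (extend-rung R t restrict-isEquivalence rungState-consistent r)
                                        (rungJoined-rungState R′ eR′ r)

  count-by-restriction : ∀ (Y : RungState → Bool) →
    count (λ R′ → isComposition G′ R′ ∧ Y (rungState R′)) (allRels m′) ≡
    sum (map (λ R → count (λ t → isComposition G R ∧ (consistent (endsJoined R) t ∧ Y t)) rungStates) (allRels m))
  count-by-restriction Y = trans
    (count-bijection (allRels-unique m′) (Unique.cartesianProduct⁺ (allRels-unique m) rungStates-unique)
      (allRels-complete m′) (λ (R , t) → ∈-cartesianProduct⁺ (allRels-complete m R) (rungStates-complete t))
      p q (λ R′ → restrict R′ , rungState R′) (λ (R , t) → extend R t) p⇒q q⇒p restore cut)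
    (count-cartesianProduct q (allRels m) rungStates)
    where
    p : Rel m′ → Bool
    p R′ = isComposition G′ R′ ∧ Y (rungState R′)
    q : Rel m × RungState → Bool
    q (R , t) = isComposition G R ∧ (consistent (endsJoined R) t ∧ Y t)

    p⇒q : ∀ R′ → p R′ ≡ true → q (restrict R′ , rungState R′) ≡ true
    p⇒q R′ h = ∧-intro (isComposition-complete (restrict-isComposition cR′))
                       (∧-intro (rungState-consistent cR′) (∧-elimʳ {isComposition G′ R′} h))
      where cR′ = isComposition-sound (∧-elimˡ h)

    q⇒p : ∀ Rt → q Rt ≡ true → p (extend (proj₁ Rt) (proj₂ Rt)) ≡ true
    q⇒p (R , t) h = ∧-intro (isComposition-complete (extend-isComposition cR c))
                            (trans (cong Y (rungState-extend R t (IsComposition.equivalence cR) c)) y)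
      where
      cR = isComposition-sound (∧-elimˡ h)
      c = ∧-elimˡ (∧-elimʳ {isComposition G R} h)
      y = ∧-elimʳ {consistent (endsJoined R) t} (∧-elimʳ {isComposition G R} h)

    restore : ∀ R′ → p R′ ≡ true → extend (restrict R′) (rungState R′) ≡ R′
    restore R′ h = extend-restrict (isComposition-sound (∧-elimˡ h))

    cut : ∀ Rt → q Rt ≡ true → (restrict (extend (proj₁ Rt) (proj₂ Rt)) , rungState (extend (proj₁ Rt) (proj₂ Rt))) ≡ Rt
    cut (R , t) h = cong₂ _,_ (restrict-extend R t)
                              (rungState-extend R t (IsComposition.equivalence cR) (∧-elimˡ (∧-elimʳ {isComposition G R} h)))
      where cR = isComposition-sound (∧-elimˡ h)

  joined split : ℕ
  joined = count (λ R → isComposition G R ∧ endsJoined R) (allRels m)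
  split  = count (λ R → isComposition G R ∧ not (endsJoined R)) (allRels m)

  count-compositions : count (isComposition G′) (allRels m′) ≡ 5 * joined + 7 * split
  count-compositions = begin
    count (isComposition G′) (allRels m′)
      ≡⟨ count-cong (allRels m′) (λ R′ → sym (∧-identityʳ (isComposition G′ R′))) ⟩
    count (λ R′ → isComposition G′ R′ ∧ true) (allRels m′)
      ≡⟨ count-by-restriction (λ _ → true) ⟩
    sum (map (λ R → count (λ t → isComposition G R ∧ (consistent (endsJoined R) t ∧ true)) rungStates) (allRels m))
      ≡⟨ sum-by-classes (isComposition G) endsJoined 5 7 _ weight (allRels m) ⟩
    5 * joined + 7 * split ∎
    where
    open ≡-Reasoning
    weight : ∀ R → count (λ t → isComposition G R ∧ (consistent (endsJoined R) t ∧ true)) rungStates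
                   ≡ (if isComposition G R then (if endsJoined R then 5 else 7) else 0)
    weight R with isComposition G R | endsJoined R
    ... | true  | true  = refl
    ... | true  | false = refl
    ... | false | _     = refl

  count-rung-joined : count (λ R′ → isComposition G′ R′ ∧ rel R′ (new zero) (new (suc zero))) (allRels m′)
                      ≡ 2 * joined + 3 * split
  count-rung-joined =
    trans (count-by-restriction rungJoined) (sum-by-classes (isComposition G) endsJoined 2 3 _ weight (allRels m))
    where
    weight : ∀ R → count (λ t → isComposition G R ∧ (consistent (endsJoined R) t ∧ rungJoined t)) rungStates
                   ≡ (if isComposition G R then (if endsJoined R then 2 else 3) else 0)
    weight R with isComposition G R | endsJoined R
    ... | true  | true  = refl
    ... | true  | false = refl
    ... | false | _     = refl

-- Ladders

==-sym : ∀ {n} (i j : Fin n) → (i == j) ≡ (j == i)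
==-sym i j = true-ext (λ h → subst (λ k → (k == i) ≡ true) (==⇒≡ {i = i} {j} h) (==-refl i))
                      (λ h → subst (λ k → (k == j) ≡ true) (==⇒≡ {i = j} {i} h) (==-refl j))

combine-cases : ∀ {m k} (P : Fin (m * k) → Set) → (∀ r c → P (combine r c)) → ∀ x → P x
combine-cases {m} {k} P P-combine x =
  subst P (combine-remQuot {m} k x) (P-combine (proj₁ (remQuot {m} k x)) (proj₂ (remQuot {m} k x)))

module _ {m k} (G : Graph m) (H : Graph k) where

  □-adj : ∀ r r′ c c′ → adj (G □ H) (combine r c) (combine r′ c′) ≡
          ((r == r′) ∧ adj H c c′) ∨ ((c == c′) ∧ adj G r r′)
  □-adj r r′ c c′ = cong₂ (λ (u₁ , u₂) (v₁ , v₂) → ((u₁ == v₁) ∧ adj H u₂ v₂) ∨ ((u₂ == v₂) ∧ adj G u₁ v₁))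
    (remQuot-combine {m} {k} r c) (remQuot-combine {m} {k} r′ c′)

  □-sym : (∀ r r′ → adj G r r′ ≡ adj G r′ r) → (∀ c c′ → adj H c c′ ≡ adj H c′ c) →
          ∀ x y → adj (G □ H) x y ≡ adj (G □ H) y x
  □-sym G-sym H-sym = combine-cases {m} {k} _ λ r c → combine-cases {m} {k} _ λ r′ c′ → begin
    adj (G □ H) (combine r c) (combine r′ c′)            ≡⟨ □-adj r r′ c c′ ⟩
    ((r == r′) ∧ adj H c c′) ∨ ((c == c′) ∧ adj G r r′)
      ≡⟨ cong₂ _∨_ (cong₂ _∧_ (==-sym r r′) (H-sym c c′)) (cong₂ _∧_ (==-sym c c′) (G-sym r r′)) ⟩
    ((r′ == r) ∧ adj H c′ c) ∨ ((c′ == c) ∧ adj G r′ r)  ≡⟨ □-adj r′ r c′ c ⟨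
    adj (G □ H) (combine r′ c′) (combine r c)            ∎
    where open ≡-Reasoning

Path-sym : ∀ n (i j : Fin n) → adj (Path n) i j ≡ adj (Path n) j i
Path-sym n i j = ∨-comm (suc (toℕ i) ≡ᵇ toℕ j) (suc (toℕ j) ≡ᵇ toℕ i)

Path-inject₁ : ∀ n (i j : Fin n) → adj (Path (suc n)) (inject₁ i) (inject₁ j) ≡ adj (Path n) i j
Path-inject₁ n i j rewrite toℕ-inject₁ i | toℕ-inject₁ j = refl

≡ᵇ-intro : ∀ {m n} → m ≡ n → (m ≡ᵇ n) ≡ true
≡ᵇ-intro {m} {n} eq = Equivalence.to T-≡ (≡⇒≡ᵇ m n eq)

≡ᵇ-elim : ∀ {m n} → (m ≡ᵇ n) ≡ true → m ≡ n
≡ᵇ-elim {m} {n} h = ≡ᵇ⇒≡ m n (Equivalence.from T-≡ h)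

Path-last : ∀ k → adj (Path (suc (suc k))) (inject₁ (fromℕ k)) (fromℕ (suc k)) ≡ true
Path-last k rewrite toℕ-inject₁ (fromℕ k) | toℕ-fromℕ k = ∨-introˡ (≡ᵇ-intro {suc k} refl)

Path-to-last : ∀ k (i : Fin (suc k)) → adj (Path (suc (suc k))) (inject₁ i) (fromℕ (suc k)) ≡ true → i ≡ fromℕ k
Path-to-last k i a rewrite toℕ-inject₁ i | toℕ-fromℕ k with ∨-elim a
... | inj₁ next = toℕ-injective (trans (suc-injective (≡ᵇ-elim next)) (sym (toℕ-fromℕ k)))
... | inj₂ beyond = ⊥-elim (<⇒≱ (toℕ<n i) (≤-trans (n≤1+n (suc k)) (≤-reflexive (≡ᵇ-elim beyond))))

==-inject₁ : ∀ {n} (i j : Fin n) → (inject₁ i == inject₁ j) ≡ (i == j)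
==-inject₁ i j = true-ext (λ h → subst (λ k → (i == k) ≡ true) (inject₁-injective (==⇒≡ h)) (==-refl i))
                          (λ h → subst (λ k → (inject₁ i == inject₁ k) ≡ true) (==⇒≡ {i = i} {j} h) (==-refl (inject₁ i)))

Path₂-other : ∀ r → adj (Path 2) r (other r) ≡ true
Path₂-other zero = refl
Path₂-other (suc zero) = refl

Ladder-adj : ∀ n r r′ c c′ → adj (Ladder n) (combine r c) (combine r′ c′) ≡
             ((r == r′) ∧ adj (Path n) c c′) ∨ ((c == c′) ∧ adj (Path 2) r r′)
Ladder-adj n = □-adj (Path 2) (Path n)

Ladder-rung : ∀ n r c → adj (Ladder n) (combine r c) (combine (other r) c) ≡ true
Ladder-rung n r c = trans (Ladder-adj n r (other r) c c)
  (∨-introʳ ((r == other r) ∧ adj (Path n) c c) (∧-intro (==-refl c) (Path₂-other r)))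

Ladder-sym : ∀ n x y → adj (Ladder n) x y ≡ true → adj (Ladder n) y x ≡ true
Ladder-sym n x y a = trans (□-sym (Path 2) (Path n) (Path-sym 2) (Path-sym n) y x) a

corner : ∀ k → Fin 2 → Fin (2 * suc k)
corner k r = combine r (fromℕ k)

module _ (k : ℕ) where

  private
    n = suc k

  shift : Fin (2 * n) → Fin (2 * suc n)
  shift x = uncurry (λ r c → combine r (inject₁ c)) (remQuot {2} n x)

  shift-combine : ∀ r c → shift (combine r c) ≡ combine r (inject₁ c)
  shift-combine r c = cong (uncurry λ r c → combine r (inject₁ c)) (remQuot-combine {2} {n} r c)

  fromColumn : Fin 2 → {c : Fin (suc n)} → View c → Fin (2 * n) ⊎ Fin 2
  fromColumn r ‵fromℕ = inj₂ r
  fromColumn r (‵inject₁ c) = inj₁ (combine r c)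

  ladderOrigin : Fin (2 * suc n) → Fin (2 * n) ⊎ Fin 2
  ladderOrigin z = uncurry (λ r c → fromColumn r (view c)) (remQuot {2} (suc n) z)

  ladderOrigin-combine : ∀ r c → ladderOrigin (combine r c) ≡ fromColumn r (view c)
  ladderOrigin-combine r c = cong (uncurry λ r c → fromColumn r (view c)) (remQuot-combine {2} {suc n} r c)

  ladderOrigin-shift : ∀ x → ladderOrigin (shift x) ≡ inj₁ x
  ladderOrigin-shift = combine-cases {2} {n} _ λ r c → begin
    ladderOrigin (shift (combine r c))       ≡⟨ cong ladderOrigin (shift-combine r c) ⟩
    ladderOrigin (combine r (inject₁ c))     ≡⟨ ladderOrigin-combine r (inject₁ c) ⟩
    fromColumn r (view (inject₁ c))          ≡⟨ cong (fromColumn r) (view-inject₁ c) ⟩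
    inj₁ (combine r c)                       ∎
    where open ≡-Reasoning

  ladderOrigin-corner : ∀ r → ladderOrigin (corner n r) ≡ inj₂ r
  ladderOrigin-corner r = trans (ladderOrigin-combine r (fromℕ n)) (cong (fromColumn r) (view-fromℕ n))

  ladderOrigin-section : ∀ z → [ shift , corner n ] (ladderOrigin z) ≡ z
  ladderOrigin-section = combine-cases {2} {suc n} _ λ r c →
    trans (cong [ shift , corner n ] (ladderOrigin-combine r c))
          (trans (section r (view c)) (cong (combine r) (view-complete (view c))))
    where
    section : ∀ r {c} (v : View c) → [ shift , corner n ] (fromColumn r v) ≡ combine r ⟦ v ⟧
    section r ‵fromℕ = refl
    section r (‵inject₁ c) = shift-combine r c

  shift-adj : ∀ x y → adj (Ladder (suc n)) (shift x) (shift y) ≡ adj (Ladder n) x y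
  shift-adj = combine-cases {2} {n} _ λ r c → combine-cases {2} {n} _ λ r′ c′ → begin
    adj (Ladder (suc n)) (shift (combine r c)) (shift (combine r′ c′))
      ≡⟨ cong₂ (adj (Ladder (suc n))) (shift-combine r c) (shift-combine r′ c′) ⟩
    adj (Ladder (suc n)) (combine r (inject₁ c)) (combine r′ (inject₁ c′))
      ≡⟨ Ladder-adj (suc n) r r′ (inject₁ c) (inject₁ c′) ⟩
    ((r == r′) ∧ adj (Path (suc n)) (inject₁ c) (inject₁ c′)) ∨ ((inject₁ c == inject₁ c′) ∧ adj (Path 2) r r′)
      ≡⟨ cong₂ (λ a b → ((r == r′) ∧ a) ∨ (b ∧ adj (Path 2) r r′)) (Path-inject₁ n c c′) (==-inject₁ c c′) ⟩
    ((r == r′) ∧ adj (Path n) c c′) ∨ ((c == c′) ∧ adj (Path 2) r r′)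
      ≡⟨ Ladder-adj n r r′ c c′ ⟨
    adj (Ladder n) (combine r c) (combine r′ c′) ∎
    where open ≡-Reasoning

  shift-adj-corner : ∀ x r → adj (Ladder (suc n)) (shift x) (corner n r) ≡ true → x ≡ corner k r
  shift-adj-corner = combine-cases {2} {n} _ λ r₀ c r a →
    to-corner r₀ c r (∨-elim (trans (sym (Ladder-adj (suc n) r₀ r (inject₁ c) (fromℕ n)))
                                   (trans (cong (λ x → adj (Ladder (suc n)) x (corner n r)) (sym (shift-combine r₀ c))) a)))
    where
    to-corner : ∀ r₀ c r → ((r₀ == r) ∧ adj (Path (suc n)) (inject₁ c) (fromℕ n)) ≡ true
                         ⊎ ((inject₁ c == fromℕ n) ∧ adj (Path 2) r₀ r) ≡ true → combine r₀ c ≡ corner k r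
    to-corner r₀ c r (inj₁ h) with refl ← ==⇒≡ {i = r₀} {r} (∧-elimˡ h) =
      cong (combine r₀) (Path-to-last k c (∧-elimʳ {r₀ == r} h))
    to-corner r₀ c r (inj₂ h) = ⊥-elim (fromℕ≢inject₁ (sym (==⇒≡ (∧-elimˡ {inject₁ c == fromℕ n} h))))

  shift-corner-adj : ∀ r → adj (Ladder (suc n)) (shift (corner k r)) (corner n r) ≡ true
  shift-corner-adj r = trans (cong (λ x → adj (Ladder (suc n)) x (corner n r)) (shift-combine r (fromℕ k)))
    (trans (Ladder-adj (suc n) r r (inject₁ (fromℕ k)) (fromℕ n)) (∨-introˡ (∧-intro (==-refl r) (Path-last k))))

  ladderExtension : RungExtension (Ladder n) (Ladder (suc n))
  ladderExtension = record
    { old            = shift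
    ; new            = corner n
    ; end            = corner k
    ; origin         = ladderOrigin
    ; origin-old     = ladderOrigin-shift
    ; origin-new     = ladderOrigin-corner
    ; origin-section = ladderOrigin-section
    ; adj-old-old    = shift-adj
    ; adj-old-new    = shift-adj-corner
    ; adj-end-new    = shift-corner-adj
    ; adj-new-new    = λ r → Ladder-rung (suc n) r (fromℕ n)
    ; adj-end-end    = λ r → Ladder-rung n r (fromℕ k)
    ; adj′-sym       = Ladder-sym (suc n)
    }

module LadderStep (k : ℕ) = RungExtensionProperties (ladderExtension k)
open LadderStep using (joined; split)

C-Ladder-split : ∀ k → C (Ladder (suc k)) ≡ joined k + split k
C-Ladder-split k = count-split (isComposition (Ladder (suc k))) (LadderStep.endsJoined k) (allRels (2 * suc k))

C-Ladder-step : ∀ k → C (Ladder (suc (suc k))) ≡ 5 * joined k + 7 * split k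
C-Ladder-step = LadderStep.count-compositions

joined-step : ∀ k → joined (suc k) ≡ 2 * joined k + 3 * split k
joined-step = LadderStep.count-rung-joined

split-step : ∀ k → split (suc k) ≡ 3 * joined k + 4 * split k
split-step k = +-cancelˡ-≡ (joined (suc k)) _ _ (begin
  joined (suc k) + split (suc k)                    ≡⟨ C-Ladder-split (suc k) ⟨
  C (Ladder (suc (suc k)))                          ≡⟨ C-Ladder-step k ⟩
  5 * joined k + 7 * split k                        ≡⟨ sum-of-steps (joined k) (split k) ⟩
  (2 * joined k + 3 * split k) + (3 * joined k + 4 * split k)
    ≡⟨ cong (_+ (3 * joined k + 4 * split k)) (joined-step k) ⟨
  joined (suc k) + (3 * joined k + 4 * split k)     ∎)
  where
  open ≡-Reasoning
  sum-of-steps : ∀ J S → 5 * J + 7 * S ≡ (2 * J + 3 * S) + (3 * J + 4 * S)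
  sum-of-steps = solve-∀

theorem9 : (C (Ladder 1) ≡ 2) × (C (Ladder 2) ≡ 12) ×
    (∀ (n : ℕ) → C (Ladder (suc (suc (suc n))))
    ≡ 6 * C (Ladder (suc (suc n))) + C (Ladder (suc n)))
theorem9 = refl , refl , λ n → begin
  C (Ladder (suc (suc (suc n))))                              ≡⟨ C-Ladder-step (suc n) ⟩
  5 * joined (suc n) + 7 * split (suc n)                      ≡⟨ cong₂ (λ J S → 5 * J + 7 * S) (joined-step n) (split-step n) ⟩
  5 * (2 * joined n + 3 * split n) + 7 * (3 * joined n + 4 * split n)
    ≡⟨ regroup (joined n) (split n) ⟩
  6 * (5 * joined n + 7 * split n) + (joined n + split n)
    ≡⟨ cong₂ (λ a b → 6 * a + b) (C-Ladder-step n) (C-Ladder-split n) ⟨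
  6 * C (Ladder (suc (suc n))) + C (Ladder (suc n))           ∎
  where
  open ≡-Reasoning
  regroup : ∀ J S → 5 * (2 * J + 3 * S) + 7 * (3 * J + 4 * S) ≡ 6 * (5 * J + 7 * S) + (J + S)
  regroup = solve-∀
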